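{- Let $n\ge1$, let $\pi=\pi_1\cdots\pi_n\in\mathcal S_n$ with $\pi_1=i$, and let $\pi'=\mathrm{red}(\pi_2\cdots\pi_n)\in\mathcal S_{n-1}$. Then $$\mathrm{weight}(\pi)=x_{i,1}^{0}x_{i,2}^{1}\cdots x_{i,i}^{i-1}\cdot\mathrm{weight}(\pi')\big|_{A'},$$ where $A'$ is the simultaneous substitution, for the variables $x_{b,c},y_{b,c}$ ($1\le c\le b\le n-1$) of $\mathrm{weight}(\pi')$: $x_{b,c}\to y_{i,c}\,x_{b+1,c}$ if $b\ge i,\ c<i$; $x_{b,c}\to x_{b+1,c+1}$ if $b\ge i,\ c>i$; $x_{b,c}\to y_{i,i}\,x_{b+1,c}\,x_{b+1,c+1}$ if $b\ge i,\ c=i$; $y_{b,c}\to y_{b+1,c}$ if $b\ge i,\ c<i$; $y_{b,c}\to y_{b+1,c+1}$ if $b\ge i,\ c>i$; $y_{b,c}\to t\,y_{b+1,c}\,y_{b+1,c+1}$ if $b\ge i,\ c=i$; and all variables with $b<i$ are left unchanged.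
   Context: For a sequence $\sigma$ of $k$ distinct positive integers, $\mathrm{red}(\sigma)$ is the unique $\tau\in\mathcal S_k$ order-isomorphic to $\sigma$. For $\pi\in\mathcal S_m$, $N_{2341}(\pi)$ is the number of index quadruples $a<b<c<d$ with $\mathrm{red}(\pi_a\pi_b\pi_c\pi_d)=2341$. With variables $t$, $x_{i,j}$ and $y_{i,j}$ ($1\le j\le i$), define $$\mathrm{weight}(\pi)=t^{N_{2341}(\pi)}\prod_{1\le j\le i\le m}x_{i,j}^{\#\{(a,b):\,a<b,\ \pi_a>\pi_b,\ \pi_a=i,\ \pi_b<j\}}\;y_{i,j}^{\#\{(a,b,c):\,a<b<c,\ \pi_c<\pi_a<\pi_b,\ \pi_a=i,\ \pi_c<j\}},$$ all indices ranging in $\{1,\dots,m\}$. -}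

module Defs where

open import Data.Bool using (Bool; true; false; if_then_else_; _∧_)
open import Data.Nat using (ℕ; zero; suc; _+_; _*_; _∸_; _≡ᵇ_; _<ᵇ_; _≤ᵇ_)
open import Data.List using (List; []; _∷_; map; upTo; length)
open import Data.Product using (_×_)
open import Relation.Binary.PropositionalEquality using (_≡_)
open import Data.List.Relation.Binary.Permutation.Propositional using (_↭_)

oneTo : ℕ → List ℕ
oneTo n = map suc (upTo n)

-- π is a permutation in S_n (one-line notation π₁ ⋯ πₙ)
IsPerm : ℕ → List ℕ → Set
IsPerm n π = π ↭ oneTo n

countB : {A : Set} → (A → Bool) → List A → ℕ
countB p [] = 0
countB p (x ∷ xs) = (if p x then 1 else 0) + countB p xs

-- red σ : standardisation of a sequence of distinct positive integers:
-- each entry v is replaced by its rank 1 + #{entries < v}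
red : List ℕ → List ℕ
red σ = map (λ v → suc (countB (λ w → w <ᵇ v) σ)) σ

-- all subsequences of length k (entries in original order),
-- i.e. all index tuples a₁ < ⋯ < a_k
subs : ℕ → List ℕ → List (List ℕ)
subs zero xs = [] ∷ []
subs (suc k) [] = []
subs (suc k) (x ∷ xs) = Data.List._++_ (map (x ∷_) (subs k xs)) (subs (suc k) xs)

listEqᵇ : List ℕ → List ℕ → Bool
listEqᵇ [] [] = true
listEqᵇ (x ∷ xs) (y ∷ ys) = (x ≡ᵇ y) ∧ listEqᵇ xs ys
listEqᵇ _ _ = false

N2341 : List ℕ → ℕ
N2341 π = countB (λ s → listEqᵇ (red s) (2 ∷ 3 ∷ 4 ∷ 1 ∷ [])) (subs 4 π)

-- Monomials in t, x_{i,j}, y_{i,j}: given by their exponents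

record Mono : Set where
  field
    texp : ℕ
    xexp : ℕ → ℕ → ℕ
    yexp : ℕ → ℕ → ℕ
open Mono public

_≈_ : Mono → Mono → Set
M ≈ N = (texp M ≡ texp N) × ((i j : ℕ) → xexp M i j ≡ xexp N i j)
                          × ((i j : ℕ) → yexp M i j ≡ yexp N i j)

one : Mono
one = record { texp = 0 ; xexp = λ _ _ → 0 ; yexp = λ _ _ → 0 }

_·_ : Mono → Mono → Mono
M · N = record { texp = texp M + texp N
               ; xexp = λ i j → xexp M i j + xexp N i j
               ; yexp = λ i j → yexp M i j + yexp N i j }

_^^_ : Mono → ℕ → Mono
M ^^ k = record { texp = k * texp M
                ; xexp = λ i j → k * xexp M i j
                ; yexp = λ i j → k * yexp M i j }

tv : Mono
tv = record one { texp = 1 }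

δ : ℕ → ℕ → ℕ → ℕ → ℕ
δ i j i' j' = if (i' ≡ᵇ i) ∧ (j' ≡ᵇ j) then 1 else 0

xv : ℕ → ℕ → Mono
xv i j = record one { xexp = δ i j }

yv : ℕ → ℕ → Mono
yv i j = record one { yexp = δ i j }

prodTo : ℕ → (ℕ → Mono) → Mono
prodTo zero f = one
prodTo (suc m) f = prodTo m f · f (suc m)

inRange : ℕ → ℕ → Bool
inRange i j = (1 ≤ᵇ j) ∧ (j ≤ᵇ i)

-- exponent of x_{i,j}: #{(a,b): a<b, π_a > π_b, π_a = i, π_b < j}
xCount : List ℕ → ℕ → ℕ → ℕ
xCount π i j = countB f (subs 2 π)
  where
  f : List ℕ → Bool
  f (p ∷ q ∷ []) = (q <ᵇ p) ∧ ((p ≡ᵇ i) ∧ (q <ᵇ j))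
  f _ = false

-- exponent of y_{i,j}: #{(a,b,c): a<b<c, π_c < π_a < π_b, π_a = i, π_c < j}
yCount : List ℕ → ℕ → ℕ → ℕ
yCount π i j = countB f (subs 3 π)
  where
  f : List ℕ → Bool
  f (p ∷ q ∷ r ∷ []) = (r <ᵇ p) ∧ ((p <ᵇ q) ∧ ((p ≡ᵇ i) ∧ (r <ᵇ j)))
  f _ = false

-- (only variables with 1 ≤ j ≤ i occur; for a permutation of [1..m]
--  every variable with nonzero exponent automatically has i ≤ m)
weight : List ℕ → Mono
weight π = record
  { texp = N2341 π
  ; xexp = λ i j → if inRange i j then xCount π i j else 0
  ; yexp = λ i j → if inRange i j then yCount π i j else 0 }

prefactor : ℕ → Mono
prefactor i = prodTo i (λ j → xv i j ^^ (j ∸ 1))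

substX : ℕ → ℕ → ℕ → Mono
substX i b c =
  if b <ᵇ i then xv b c
  else if c <ᵇ i then yv i c · xv (suc b) c
  else if i <ᵇ c then xv (suc b) (suc c)
  else yv i i · (xv (suc b) c · xv (suc b) (suc c))

substY : ℕ → ℕ → ℕ → Mono
substY i b c =
  if b <ᵇ i then yv b c
  else if c <ᵇ i then yv (suc b) c
  else if i <ᵇ c then yv (suc b) (suc c)
  else tv · (yv (suc b) c · yv (suc b) (suc c))

-- apply the monoid homomorphism determined by A' (t ↦ t, and the
-- variables x_{b,c}, y_{b,c}, 1 ≤ c ≤ b ≤ m, mapped as above) to M
applyA' : ℕ → ℕ → Mono → Mono
applyA' i m M =
  (tv ^^ texp M) ·
  prodTo m (λ b → prodTo b (λ c →
     (substX i b c ^^ xexp M b c) · (substY i b c ^^ yexp M b c)))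

-- The weight factors as t^N₂₃₄₁(π) times one run of variables per inversion and per occurrence
-- of 231: an inversion with values p > q contributes x_{p,q+1} ⋯ x_{p,p}, and an occurrence with
-- values r < p < q (p first) contributes y_{p,r+1} ⋯ y_{p,p}.  Write π = i π₂ ⋯ πₙ.  The
-- inversions starting with i make up the prefactor.  Every other inversion or occurrence lies in
-- the tail, and A′ maps the run of its counterpart in π′ (entries above i lowered by one) back to
-- the run of the original, except where the run crosses the diagonal c = i: an inversion (p, q)
-- with q < i < p picks up y_{i,q+1} ⋯ y_{i,i}, the run of the 231-occurrence (i, p, q), and a
-- 231-occurrence (p, q, r) with r < i < p picks up t, for the 2341-occurrence (i, p, q, r).
-- These are all the inversions, 231- and 2341-occurrences of π that start with i.

module Submission where

open import Defs

open import Algebra.Bundles using (CommutativeMonoid)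
open import Data.Bool using (Bool; true; false; if_then_else_; _∧_; not; T)
import Data.Bool as Bool
open import Data.Bool.Properties using (T-≡; T-∧; ∧-zeroʳ; ∧-identityʳ)
open import Data.List using (List; []; _∷_; map; _++_; applyUpTo; length)
open import Data.List.Membership.Propositional using (_∈_)
open import Data.List.Membership.Propositional.Properties using (∈-map⁻; ∈-upTo⁻)
open import Data.List.Properties using (map-∘; map-++; map-cong-local)
import Data.List.Relation.Binary.Permutation.Propositional as ↭
open ↭ using (_↭_)
open import Data.List.Relation.Binary.Permutation.Propositional.Properties using (All-resp-↭)
open import Data.List.Relation.Unary.All using (All; []; _∷_)
import Data.List.Relation.Unary.All as Allₚ
import Data.List.Relation.Unary.All.Properties as All
import Data.List.Relation.Unary.AllPairs as AllPairs
open AllPairs using ([]; _∷_)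
open import Data.List.Relation.Unary.Unique.Propositional using (Unique)
import Data.List.Relation.Unary.Unique.Propositional.Properties as Uniqueₚ
open import Data.Nat using (ℕ; zero; suc; _+_; _*_; _∸_; _⊓_; _≤_; _<_; s≤s; z≤n; _<ᵇ_; _≤ᵇ_; _≡ᵇ_)
open import Data.Nat.Properties
open import Data.Product using (_×_; _,_; proj₁; proj₂; uncurry)
open import Data.Sum using (inj₁; inj₂)
open import Data.Vec using (Vec; []; _∷_)
open import Function using (_∘_)
open import Function.Bundles using (module Equivalence)
open import Relation.Binary.Definitions using (tri<; tri≈; tri>)
open import Relation.Binary.PropositionalEquality
  using (_≡_; _≢_; ≢-sym; refl; sym; trans; cong; cong₂; subst; setoid; module ≡-Reasoning)
import Relation.Binary.Reasoning.Setoid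
open import Relation.Nullary using (¬_; contradiction; yes; no)
open import Relation.Nullary.Decidable using (⌊_⌋; toWitness)

open import Data.List.Relation.Binary.Permutation.Setoid.Properties (setoid ℕ) using (Unique-resp-↭)
import Algebra.Properties.CommutativeSemigroup +-commutativeSemigroup as +-CS

ι : Bool → ℕ
ι b = if b then 1 else 0

¬T⇒≡false : ∀ {b} → ¬ T b → b ≡ false
¬T⇒≡false {false} _ = refl
¬T⇒≡false {true} ¬t = contradiction _ ¬t

<ᵇ-true : ∀ {a b} → a < b → (a <ᵇ b) ≡ true
<ᵇ-true a<b = Equivalence.to T-≡ (<⇒<ᵇ a<b)

<ᵇ-false : ∀ {a b} → b ≤ a → (a <ᵇ b) ≡ false
<ᵇ-false {a} {b} b≤a = ¬T⇒≡false (λ t → <⇒≱ (<ᵇ⇒< a b t) b≤a)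

<ᵇ-true⁻¹ : ∀ {a b} → (a <ᵇ b) ≡ true → a < b
<ᵇ-true⁻¹ {a} {b} eq = <ᵇ⇒< a b (Equivalence.from T-≡ eq)

<ᵇ-false⁻¹ : ∀ {a b} → (a <ᵇ b) ≡ false → b ≤ a
<ᵇ-false⁻¹ eq = ≮⇒≥ (λ a<b → subst T eq (<⇒<ᵇ a<b))

<ᵇ-irrefl : ∀ a → (a <ᵇ a) ≡ false
<ᵇ-irrefl a = <ᵇ-false {a} ≤-refl

<ᵇ-flip : ∀ {a b} → a ≢ b → (b <ᵇ a) ≡ not (a <ᵇ b)
<ᵇ-flip {a} {b} a≢b with <-cmp a b
... | tri< a<b _ _ rewrite <ᵇ-true a<b | <ᵇ-false {b} {a} (<⇒≤ a<b) = refl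
... | tri≈ _ a≡b _ = contradiction a≡b a≢b
... | tri> _ _ b<a rewrite <ᵇ-true b<a | <ᵇ-false {a} {b} (<⇒≤ b<a) = refl

≤ᵇ-true : ∀ {a b} → a ≤ b → (a ≤ᵇ b) ≡ true
≤ᵇ-true a≤b = Equivalence.to T-≡ (≤⇒≤ᵇ a≤b)

≤ᵇ-false : ∀ {a b} → b < a → (a ≤ᵇ b) ≡ false
≤ᵇ-false {a} {b} b<a = ¬T⇒≡false (λ t → <⇒≱ b<a (≤ᵇ⇒≤ a b t))

≡ᵇ-refl : ∀ n → (n ≡ᵇ n) ≡ true
≡ᵇ-refl n = Equivalence.to T-≡ (≡⇒≡ᵇ n n refl)

≡ᵇ-false : ∀ {m n} → m ≢ n → (m ≡ᵇ n) ≡ false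
≡ᵇ-false {m} {n} m≢n = ¬T⇒≡false (m≢n ∘ ≡ᵇ⇒≡ m n)

-- The commutative monoid of monomials

≈-refl : {M : Mono} → M ≈ M
≈-refl = refl , (λ _ _ → refl) , (λ _ _ → refl)

≈-sym : {M N : Mono} → M ≈ N → N ≈ M
≈-sym (t , x , y) = sym t , (λ i j → sym (x i j)) , (λ i j → sym (y i j))

≈-trans : {M N P : Mono} → M ≈ N → N ≈ P → M ≈ P
≈-trans (t , x , y) (t′ , x′ , y′) =
  trans t t′ , (λ i j → trans (x i j) (x′ i j)) , (λ i j → trans (y i j) (y′ i j))

≡⇒≈ : {M N : Mono} → M ≡ N → M ≈ N
≡⇒≈ refl = ≈-refl

·-cong : {M M′ N N′ : Mono} → M ≈ M′ → N ≈ N′ → (M · N) ≈ (M′ · N′)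
·-cong (t , x , y) (t′ , x′ , y′) =
  cong₂ _+_ t t′ , (λ i j → cong₂ _+_ (x i j) (x′ i j)) , (λ i j → cong₂ _+_ (y i j) (y′ i j))

·-assoc : (M N P : Mono) → ((M · N) · P) ≈ (M · (N · P))
·-assoc M N P =
  +-assoc (texp M) _ _ , (λ i j → +-assoc (xexp M i j) _ _) , (λ i j → +-assoc (yexp M i j) _ _)

·-comm : (M N : Mono) → (M · N) ≈ (N · M)
·-comm M N = +-comm (texp M) _ , (λ i j → +-comm (xexp M i j) _) , (λ i j → +-comm (yexp M i j) _)

·-identityʳ : (M : Mono) → (M · one) ≈ M
·-identityʳ M =
  +-identityʳ (texp M) , (λ i j → +-identityʳ (xexp M i j)) , (λ i j → +-identityʳ (yexp M i j))

·-commutativeMonoid : CommutativeMonoid _ _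
·-commutativeMonoid = record
  { Carrier = Mono ; _≈_ = _≈_ ; _∙_ = _·_ ; ε = one
  ; isCommutativeMonoid = record
    { isMonoid = record
      { isSemigroup = record
        { isMagma = record
          { isEquivalence = record { refl = ≈-refl ; sym = ≈-sym ; trans = ≈-trans }
          ; ∙-cong = ·-cong }
        ; assoc = ·-assoc }
      ; identity = (λ _ → ≈-refl) , ·-identityʳ }
    ; comm = ·-comm } }

open import Algebra.Solver.CommutativeMonoid ·-commutativeMonoid using (solve; _⊜_; _⊕_; id)
module ≈-Reasoning = Relation.Binary.Reasoning.Setoid (CommutativeMonoid.setoid ·-commutativeMonoid)

^^-distrib-+ : (M : Mono) (a b : ℕ) → (M ^^ (a + b)) ≈ ((M ^^ a) · (M ^^ b))
^^-distrib-+ M a b =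
  *-distribʳ-+ (texp M) a b , (λ i j → *-distribʳ-+ (xexp M i j) a b) , (λ i j → *-distribʳ-+ (yexp M i j) a b)

^^-identityʳ : (M : Mono) → (M ^^ 1) ≈ M
^^-identityʳ M =
  +-identityʳ (texp M) , (λ i j → +-identityʳ (xexp M i j)) , (λ i j → +-identityʳ (yexp M i j))

open import Algebra.Properties.CommutativeSemigroup
  (CommutativeMonoid.commutativeSemigroup ·-commutativeMonoid) using (interchange)

^^-congʳ : ∀ (M : Mono) {a b} → a ≡ b → (M ^^ a) ≈ (M ^^ b)
^^-congʳ M refl = ≈-refl

prodTo-cong : ∀ m {f g : ℕ → Mono} → (∀ k → k ≤ m → f k ≈ g k) → prodTo m f ≈ prodTo m g
prodTo-cong zero f≈g = ≈-refl
prodTo-cong (suc m) f≈g = ·-cong (prodTo-cong m (λ k k≤m → f≈g k (m≤n⇒m≤1+n k≤m))) (f≈g (suc m) ≤-refl)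

prodTo-distrib-· : ∀ m (f g : ℕ → Mono) → prodTo m (λ k → f k · g k) ≈ (prodTo m f · prodTo m g)
prodTo-distrib-· zero f g = ≈-refl
prodTo-distrib-· (suc m) f g =
  ≈-trans (·-cong (prodTo-distrib-· m f g) (≈-refl {f (suc m) · g (suc m)}))
          (interchange (prodTo m f) (prodTo m g) (f (suc m)) (g (suc m)))

prodTo-trivial : ∀ m {f : ℕ → Mono} → (∀ k → k ≤ m → f k ≈ one) → prodTo m f ≈ one
prodTo-trivial zero f≈1 = ≈-refl
prodTo-trivial (suc m) f≈1 =
  ≈-trans (·-cong (prodTo-trivial m (λ k k≤m → f≈1 k (m≤n⇒m≤1+n k≤m))) (f≈1 (suc m) ≤-refl))
          (·-identityʳ one)

prodTo-single : ∀ m b {f : ℕ → Mono} → 1 ≤ b → b ≤ m → (∀ k → k ≢ b → f k ≈ one) →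
  prodTo m f ≈ f b
prodTo-single zero b 1≤b b≤0 f≈1 with ≤-trans 1≤b b≤0
... | ()
prodTo-single (suc m) b {f} 1≤b b≤1+m f≈1 with m≤n⇒m<n∨m≡n b≤1+m
... | inj₁ (s≤s b≤m) =
  ≈-trans (·-cong (prodTo-single m b 1≤b b≤m f≈1) (f≈1 (suc m) (≢-sym (<⇒≢ (s≤s b≤m)))))
          (·-identityʳ (f b))
... | inj₂ refl = ·-cong (prodTo-trivial m (λ k k≤m → f≈1 k (<⇒≢ (s≤s k≤m)))) (≈-refl {f (suc m)})

prodTo-const : ∀ k (M : Mono) → prodTo k (λ _ → M) ≈ (M ^^ k)
prodTo-const zero M = ≈-refl
prodTo-const (suc k) M = ≈-trans (·-cong (prodTo-const k M) (≈-refl {M})) (·-comm (M ^^ k) M)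

prodRange : ℕ → ℕ → (ℕ → Mono) → Mono
prodRange a zero f = one
prodRange a (suc k) f = f (suc a) · prodRange (suc a) k f

prodRange-cong : ∀ a k {f g : ℕ → Mono} → (∀ j → a < j → j ≤ a + k → f j ≈ g j) →
  prodRange a k f ≈ prodRange a k g
prodRange-cong a zero f≈g = ≈-refl
prodRange-cong a (suc k) f≈g rewrite +-suc a k =
  ·-cong (f≈g (suc a) ≤-refl (s≤s (m≤m+n a k)))
         (prodRange-cong (suc a) k (λ j a<j j≤ → f≈g j (<-trans (n<1+n a) a<j) j≤))

prodRange-trivial : ∀ a k {f : ℕ → Mono} → (∀ j → a < j → j ≤ a + k → f j ≈ one) → prodRange a k f ≈ one
prodRange-trivial a zero f≈1 = ≈-refl
prodRange-trivial a (suc k) f≈1 rewrite +-suc a k =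
  ·-cong (f≈1 (suc a) ≤-refl (s≤s (m≤m+n a k)))
         (prodRange-trivial (suc a) k (λ j a<j j≤ → f≈1 j (<-trans (n<1+n a) a<j) j≤))

prodRange-+ : ∀ a k l (f : ℕ → Mono) → prodRange a (k + l) f ≈ (prodRange a k f · prodRange (a + k) l f)
prodRange-+ a zero l f rewrite +-identityʳ a = ≈-refl
prodRange-+ a (suc k) l f rewrite +-suc a k =
  ≈-trans (·-cong (≈-refl {f (suc a)}) (prodRange-+ (suc a) k l f))
          (≈-sym (·-assoc (f (suc a)) (prodRange (suc a) k f) (prodRange (suc a + k) l f)))

prodRange-suc : ∀ a k (f : ℕ → Mono) → prodRange a (suc k) f ≈ (prodRange a k f · f (suc (a + k)))
prodRange-suc a k f = ≈-trans (≡⇒≈ (cong (λ l → prodRange a l f) (+-comm 1 k)))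
                        (≈-trans (prodRange-+ a k 1 f) (·-cong (≈-refl {prodRange a k f}) (·-identityʳ _)))

prodRange-shift : ∀ a k (f : ℕ → Mono) → prodRange a k (λ j → f (suc j)) ≈ prodRange (suc a) k f
prodRange-shift a zero f = ≈-refl
prodRange-shift a (suc k) f = ·-cong (≈-refl {f (suc (suc a))}) (prodRange-shift (suc a) k f)

prodRange-distrib-· : ∀ a k (f g : ℕ → Mono) →
  prodRange a k (λ j → f j · g j) ≈ (prodRange a k f · prodRange a k g)
prodRange-distrib-· a zero f g = ≈-refl
prodRange-distrib-· a (suc k) f g =
  ≈-trans (·-cong (≈-refl {f (suc a) · g (suc a)}) (prodRange-distrib-· (suc a) k f g))
          (interchange (f (suc a)) (g (suc a)) (prodRange (suc a) k f) (prodRange (suc a) k g))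

prodTo≈prodRange : ∀ n (f : ℕ → Mono) → prodTo n f ≈ prodRange 0 n f
prodTo≈prodRange zero f = ≈-refl
prodTo≈prodRange (suc n) f =
  ≈-trans (·-cong (prodTo≈prodRange n f) (≈-refl {f (suc n)})) (≈-sym (prodRange-suc 0 n f))

prodList : {A : Set} → (A → Mono) → List A → Mono
prodList f [] = one
prodList f (x ∷ xs) = f x · prodList f xs

prodList-++ : {A : Set} (f : A → Mono) (xs ys : List A) →
  prodList f (xs ++ ys) ≈ (prodList f xs · prodList f ys)
prodList-++ f [] ys = ≈-refl
prodList-++ f (x ∷ xs) ys =
  ≈-trans (·-cong (≈-refl {f x}) (prodList-++ f xs ys)) (≈-sym (·-assoc (f x) (prodList f xs) (prodList f ys)))

prodList-map : {A B : Set} (f : B → Mono) (g : A → B) (xs : List A) →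
  prodList f (map g xs) ≡ prodList (f ∘ g) xs
prodList-map f g [] = refl
prodList-map f g (x ∷ xs) = cong (f (g x) ·_) (prodList-map f g xs)

prodList-distrib-· : {A : Set} (f g : A → Mono) (xs : List A) →
  prodList (λ x → f x · g x) xs ≈ (prodList f xs · prodList g xs)
prodList-distrib-· f g [] = ≈-refl
prodList-distrib-· f g (x ∷ xs) =
  ≈-trans (·-cong (≈-refl {f x · g x}) (prodList-distrib-· f g xs))
          (interchange (f x) (g x) (prodList f xs) (prodList g xs))

prodList-cong : {A : Set} {P : A → Set} {f g : A → Mono} {xs : List A} →
  (∀ {x} → P x → f x ≈ g x) → All P xs → prodList f xs ≈ prodList g xs
prodList-cong f≈g [] = ≈-refl
prodList-cong f≈g (px ∷ pxs) = ·-cong (f≈g px) (prodList-cong f≈g pxs)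

prodList-↭ : {A : Set} (f : A → Mono) {xs ys : List A} → xs ↭ ys → prodList f xs ≈ prodList f ys
prodList-↭ f ↭.refl = ≈-refl
prodList-↭ f (↭.prep x p) = ·-cong (≈-refl {f x}) (prodList-↭ f p)
prodList-↭ f (↭.swap {xs} {ys} x y p) = begin
  f x · (f y · prodList f xs)
    ≈⟨ ·-cong (≈-refl {f x}) (·-cong (≈-refl {f y}) (prodList-↭ f p)) ⟩
  f x · (f y · prodList f ys)
    ≈⟨ solve 3 (λ a b c → a ⊕ (b ⊕ c) ⊜ b ⊕ (a ⊕ c)) ≈-refl (f x) (f y) (prodList f ys) ⟩
  f y · (f x · prodList f ys) ∎
  where open ≈-Reasoning
prodList-↭ f (↭.trans p q) = ≈-trans (prodList-↭ f p) (prodList-↭ f q)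

prodList-^^-ι : {A : Set} (M : Mono) (b : A → Bool) (xs : List A) →
  prodList (λ x → M ^^ ι (b x)) xs ≈ (M ^^ countB b xs)
prodList-^^-ι M b [] = ≈-refl
prodList-^^-ι M b (x ∷ xs) =
  ≈-trans (·-cong (≈-refl {M ^^ ι (b x)}) (prodList-^^-ι M b xs)) (≈-sym (^^-distrib-+ M (ι (b x)) (countB b xs)))

prodList-applyUpTo : ∀ k a {g : ℕ → ℕ} (f : ℕ → Mono) → (∀ j → g j ≡ a + j) →
  prodList f (map suc (applyUpTo g k)) ≈ prodRange a k f
prodList-applyUpTo zero a f g≗a+ = ≈-refl
prodList-applyUpTo (suc k) a f g≗a+ =
  ·-cong (≡⇒≈ (cong (f ∘ suc) (trans (g≗a+ 0) (+-identityʳ a))))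
         (prodList-applyUpTo k (suc a) f (λ j → trans (g≗a+ (suc j)) (+-suc a j)))

prodTo²-δ : ∀ m b c (G : ℕ → ℕ → ℕ → Mono) → (∀ b′ c′ → G b′ c′ 0 ≈ one) →
  1 ≤ c → c ≤ b → b ≤ m →
  prodTo m (λ b′ → prodTo b′ (λ c′ → G b′ c′ (δ b c b′ c′))) ≈ G b c 1
prodTo²-δ m b c G G0≈1 1≤c c≤b b≤m =
  ≈-trans (prodTo-single m b (≤-trans 1≤c c≤b) b≤m other-row)
    (≈-trans (prodTo-cong b (λ c′ _ → row-b c′))
      (≈-trans (prodTo-single b c 1≤c c≤b other-column) (≡⇒≈ (cong (λ z → G b c (ι z)) (≡ᵇ-refl c)))))
  where
  other-row : ∀ b′ → b′ ≢ b → prodTo b′ (λ c′ → G b′ c′ (δ b c b′ c′)) ≈ one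
  other-row b′ b′≢b = prodTo-trivial b′ (λ c′ _ →
    subst (λ z → G b′ c′ (ι (z ∧ (c′ ≡ᵇ c))) ≈ one) (sym (≡ᵇ-false b′≢b)) (G0≈1 b′ c′))
  row-b : ∀ c′ → G b c′ (δ b c b c′) ≈ G b c′ (ι (c′ ≡ᵇ c))
  row-b c′ = ≡⇒≈ (cong (λ z → G b c′ (ι (z ∧ (c′ ≡ᵇ c)))) (≡ᵇ-refl b))
  other-column : ∀ c′ → c′ ≢ c → G b c′ (ι (c′ ≡ᵇ c)) ≈ one
  other-column c′ c′≢c = subst (λ z → G b c′ (ι z) ≈ one) (sym (≡ᵇ-false c′≢c)) (G0≈1 b c′)

countB-↭ : {A : Set} (p : A → Bool) {xs ys : List A} → xs ↭ ys → countB p xs ≡ countB p ys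
countB-↭ p ↭.refl = refl
countB-↭ p (↭.prep x q) = cong (ι (p x) +_) (countB-↭ p q)
countB-↭ p (↭.swap {xs} {ys} x y q) = begin
  ι (p x) + (ι (p y) + countB p xs)  ≡⟨ cong (λ c → ι (p x) + (ι (p y) + c)) (countB-↭ p q) ⟩
  ι (p x) + (ι (p y) + countB p ys)  ≡⟨ +-CS.x∙yz≈y∙xz (ι (p x)) (ι (p y)) (countB p ys) ⟩
  ι (p y) + (ι (p x) + countB p ys)  ∎
  where open ≡-Reasoning
countB-↭ p (↭.trans q r) = trans (countB-↭ p q) (countB-↭ p r)

countB-map : {A B : Set} (p : B → Bool) (g : A → B) (xs : List A) → countB p (map g xs) ≡ countB (p ∘ g) xs
countB-map p g [] = refl
countB-map p g (x ∷ xs) = cong (ι (p (g x)) +_) (countB-map p g xs)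

countB-cong : {A : Set} {P : A → Set} {p q : A → Bool} {xs : List A} →
  (∀ {x} → P x → p x ≡ q x) → All P xs → countB p xs ≡ countB q xs
countB-cong p≗q [] = refl
countB-cong p≗q (px ∷ pxs) = cong₂ (λ b c → ι b + c) (p≗q px) (countB-cong p≗q pxs)

countB-++ : {A : Set} (p : A → Bool) (xs ys : List A) → countB p (xs ++ ys) ≡ countB p xs + countB p ys
countB-++ p [] ys = refl
countB-++ p (x ∷ xs) ys = trans (cong (ι (p x) +_) (countB-++ p xs ys)) (sym (+-assoc (ι (p x)) _ _))

if-then-countB-else-0 : {A : Set} (b : Bool) (p : A → Bool) (xs : List A) →
  (if b then countB p xs else 0) ≡ countB (λ s → b ∧ p s) xs
if-then-countB-else-0 true p xs = refl
if-then-countB-else-0 false p [] = refl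
if-then-countB-else-0 false p (x ∷ xs) = if-then-countB-else-0 false p xs

subs-map : ∀ k (g : ℕ → ℕ) xs → subs k (map g xs) ≡ map (map g) (subs k xs)
subs-map zero g xs = refl
subs-map (suc k) g [] = refl
subs-map (suc k) g (x ∷ xs) = begin
  map (g x ∷_) (subs k (map g xs)) ++ subs (suc k) (map g xs)
    ≡⟨ cong₂ _++_ (cong (map (g x ∷_)) (subs-map k g xs)) (subs-map (suc k) g xs) ⟩
  map (g x ∷_) (map (map g) (subs k xs)) ++ map (map g) (subs (suc k) xs)
    ≡⟨ cong (_++ map (map g) (subs (suc k) xs)) (trans (sym (map-∘ (subs k xs))) (map-∘ (subs k xs))) ⟩
  map (map g) (map (x ∷_) (subs k xs)) ++ map (map g) (subs (suc k) xs)
    ≡⟨ map-++ (map g) (map (x ∷_) (subs k xs)) (subs (suc k) xs) ⟨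
  map (map g) (map (x ∷_) (subs k xs) ++ subs (suc k) xs) ∎
  where open ≡-Reasoning

subs-1 : ∀ xs → subs 1 xs ≡ map (_∷ []) xs
subs-1 [] = refl
subs-1 (x ∷ xs) = cong ((x ∷ []) ∷_) (subs-1 xs)

subs-All : {P : ℕ → Set} → ∀ k {xs} → All P xs → All (All P) (subs k xs)
subs-All zero _ = [] ∷ []
subs-All (suc k) [] = []
subs-All (suc k) (px ∷ pxs) =
  All.++⁺ (All.map⁺ (Allₚ.map (px ∷_) (subs-All k pxs))) (subs-All (suc k) pxs)

subs-Unique : ∀ k {xs} → Unique xs → All Unique (subs k xs)
subs-Unique zero _ = [] ∷ []
subs-Unique (suc k) [] = []
subs-Unique (suc k) (x∉xs ∷ uxs) =
  All.++⁺ (All.map⁺ (Allₚ.zipWith (uncurry _∷_) (subs-All k x∉xs , subs-Unique k uxs)))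
          (subs-Unique (suc k) uxs)

oneTo-bounded : ∀ n → All (λ v → 1 ≤ v × v ≤ n) (oneTo n)
oneTo-bounded n = Allₚ.tabulate bounded
  where
  bounded : ∀ {v} → v ∈ oneTo n → 1 ≤ v × v ≤ n
  bounded v∈ with k , k∈ , refl ← ∈-map⁻ suc v∈ = s≤s z≤n , ∈-upTo⁻ k∈

oneTo-Unique : ∀ n → Unique (oneTo n)
oneTo-Unique n = Uniqueₚ.map⁺ suc-injective (Uniqueₚ.upTo⁺ n)

countB-<-applyUpTo : ∀ k a v {g : ℕ → ℕ} → (∀ j → g j ≡ a + j) →
  countB (_<ᵇ v) (map suc (applyUpTo g k)) ≡ k ⊓ (v ∸ suc a)
countB-<-applyUpTo zero a v g≗a+ = refl
countB-<-applyUpTo (suc k) a v {g} g≗a+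
  rewrite g≗a+ 0 | +-identityʳ a
        | countB-<-applyUpTo k (suc a) v {g ∘ suc} (λ j → trans (g≗a+ (suc j)) (+-suc a j))
  with suc a <ᵇ v in eq
... | true = cong (suc k ⊓_) (sym (+-∸-assoc 1 (<ᵇ-true⁻¹ {suc a} {v} eq)))
... | false rewrite m≤n⇒m∸n≡0 {v} (<ᵇ-false⁻¹ {suc a} eq)
                  | m≤n⇒m∸n≡0 {v} (m≤n⇒m≤1+n (<ᵇ-false⁻¹ {suc a} eq)) = ⊓-zeroʳ k

countB-<-oneTo : ∀ n v → v ≤ n → countB (_<ᵇ v) (oneTo n) ≡ v ∸ 1
countB-<-oneTo n v v≤n =
  trans (countB-<-applyUpTo n 0 v (λ _ → refl)) (m≥n⇒m⊓n≡n (≤-trans (m∸n≤m v 1) v≤n))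

IsPerm-bounded : ∀ n {π} → IsPerm n π → All (λ v → 1 ≤ v × v ≤ n) π
IsPerm-bounded n p = All-resp-↭ (↭.↭-sym p) (oneTo-bounded n)

IsPerm-Unique : ∀ n {π} → IsPerm n π → Unique π
IsPerm-Unique n p = Unique-resp-↭ (↭.↭⇒↭ₛ (↭.↭-sym p)) (oneTo-Unique n)

-- Factorising the weight into runs

xRun : ℕ → ℕ → Mono
xRun p q = prodRange q (p ∸ q) (xv p)

yRun : ℕ → ℕ → Mono
yRun p r = prodRange r (p ∸ r) (yv p)

inversionMono : List ℕ → Mono
inversionMono (p ∷ q ∷ []) = if q <ᵇ p then xRun p q else one
inversionMono _ = one

occurrenceMono : List ℕ → Mono
occurrenceMono (p ∷ q ∷ r ∷ []) = if (r <ᵇ p) ∧ (p <ᵇ q) then yRun p r else one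
occurrenceMono _ = one

factorisedWeight : List ℕ → Mono
factorisedWeight π =
  (tv ^^ N2341 π) · (prodList inversionMono (subs 2 π) · prodList occurrenceMono (subs 3 π))

module Exponent (e : Mono → ℕ) (e-one : e one ≡ 0) (e-· : ∀ M N → e (M · N) ≡ e M + e N) where

  prodList-countB : {A : Set} (F : A → Mono) (p : A → Bool) (xs : List A) →
    (∀ s → e (F s) ≡ ι (p s)) → e (prodList F xs) ≡ countB p xs
  prodList-countB F p [] eF = e-one
  prodList-countB F p (x ∷ xs) eF = trans (e-· (F x) _) (cong₂ _+_ (eF x) (prodList-countB F p xs eF))

  prodList-zero : {A : Set} (F : A → Mono) (xs : List A) → (∀ s → e (F s) ≡ 0) → e (prodList F xs) ≡ 0
  prodList-zero F [] eF = e-one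
  prodList-zero F (x ∷ xs) eF = trans (e-· (F x) _) (cong₂ _+_ (eF x) (prodList-zero F xs eF))

  prodRange-zero : ∀ a k (f : ℕ → Mono) → (∀ j → e (f j) ≡ 0) → e (prodRange a k f) ≡ 0
  prodRange-zero a zero f ef = e-one
  prodRange-zero a (suc k) f ef = trans (e-· (f (suc a)) _) (cong₂ _+_ (ef (suc a)) (prodRange-zero (suc a) k f ef))

  prodRange-indicator : ∀ J a k (f : ℕ → Mono) → (∀ j → e (f j) ≡ ι (J ≡ᵇ j)) →
    e (prodRange a k f) ≡ ι ((a <ᵇ J) ∧ (J ≤ᵇ a + k))
  prodRange-indicator J a zero f ef rewrite +-identityʳ a with a <ᵇ J in eq
  ... | false = e-one
  ... | true rewrite ≤ᵇ-false {J} {a} (<ᵇ-true⁻¹ {a} {J} eq) = e-one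
  prodRange-indicator J a (suc k) f ef rewrite +-suc a k =
    trans (e-· (f (suc a)) _) (trans (cong₂ _+_ (ef (suc a)) (prodRange-indicator J (suc a) k f ef)) step)
    where
    step : ι (J ≡ᵇ suc a) + ι ((suc a <ᵇ J) ∧ (J ≤ᵇ suc a + k)) ≡ ι ((a <ᵇ J) ∧ (J ≤ᵇ suc (a + k)))
    step with <-cmp J (suc a)
    ... | tri< J<1+a J≢1+a _
      rewrite ≡ᵇ-false J≢1+a | <ᵇ-false {suc a} {J} (<⇒≤ J<1+a) | <ᵇ-false {a} {J} (≤-pred J<1+a) = refl
    ... | tri≈ _ refl _
      rewrite ≡ᵇ-refl a | <ᵇ-irrefl (suc a) | <ᵇ-true (n<1+n a) | ≤ᵇ-true {suc a} (s≤s (m≤m+n a k)) = refl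
    ... | tri> _ J≢1+a 1+a<J
      rewrite ≡ᵇ-false J≢1+a | <ᵇ-true 1+a<J | <ᵇ-true (<-trans (n<1+n a) 1+a<J) = refl

  inversionMono-zero : (∀ p j → e (xv p j) ≡ 0) → ∀ s → e (inversionMono s) ≡ 0
  inversionMono-zero ex (p ∷ q ∷ []) with q <ᵇ p
  ... | true = prodRange-zero q (p ∸ q) (xv p) (ex p)
  ... | false = e-one
  inversionMono-zero ex [] = e-one
  inversionMono-zero ex (_ ∷ []) = e-one
  inversionMono-zero ex (_ ∷ _ ∷ _ ∷ _) = e-one

  occurrenceMono-zero : (∀ p j → e (yv p j) ≡ 0) → ∀ s → e (occurrenceMono s) ≡ 0
  occurrenceMono-zero ey (p ∷ q ∷ r ∷ []) with (r <ᵇ p) ∧ (p <ᵇ q)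
  ... | true = prodRange-zero r (p ∸ r) (yv p) (ey p)
  ... | false = e-one
  occurrenceMono-zero ey [] = e-one
  occurrenceMono-zero ey (_ ∷ []) = e-one
  occurrenceMono-zero ey (_ ∷ _ ∷ []) = e-one
  occurrenceMono-zero ey (_ ∷ _ ∷ _ ∷ _ ∷ _) = e-one


module texp-Exponent = Exponent texp refl (λ _ _ → refl)
module xexp-Exponent (I J : ℕ) = Exponent (λ M → xexp M I J) refl (λ _ _ → refl)
module yexp-Exponent (I J : ℕ) = Exponent (λ M → yexp M I J) refl (λ _ _ → refl)

xexp-xRun : ∀ I J p q → q ≤ p → xexp (xRun p q) I J ≡ ι ((I ≡ᵇ p) ∧ ((q <ᵇ J) ∧ (J ≤ᵇ p)))
xexp-xRun I J p q q≤p with I ≡ᵇ p in eq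
... | true  = trans (xexp-Exponent.prodRange-indicator I J J q (p ∸ q) (xv p)
                      (λ j → cong (λ b → ι (b ∧ (J ≡ᵇ j))) eq))
                    (cong (λ z → ι ((q <ᵇ J) ∧ (J ≤ᵇ z))) (m+[n∸m]≡n q≤p))
... | false = xexp-Exponent.prodRange-zero I J q (p ∸ q) (xv p) (λ j → cong (λ b → ι (b ∧ (J ≡ᵇ j))) eq)

yexp-yRun : ∀ I J p r → r ≤ p → yexp (yRun p r) I J ≡ ι ((I ≡ᵇ p) ∧ ((r <ᵇ J) ∧ (J ≤ᵇ p)))
yexp-yRun I J p r r≤p with I ≡ᵇ p in eq
... | true  = trans (yexp-Exponent.prodRange-indicator I J J r (p ∸ r) (yv p)
                      (λ j → cong (λ b → ι (b ∧ (J ≡ᵇ j))) eq))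
                    (cong (λ z → ι ((r <ᵇ J) ∧ (J ≤ᵇ z))) (m+[n∸m]≡n r≤p))
... | false = yexp-Exponent.prodRange-zero I J r (p ∸ r) (yv p) (λ j → cong (λ b → ι (b ∧ (J ≡ᵇ j))) eq)

-- A value q < J is at least 1, so the side condition 1 ≤ J of inRange is automatic.
inRange-∧-≡ᵇ : ∀ I J p q →
  (inRange I J ∧ ((p ≡ᵇ I) ∧ (q <ᵇ J))) ≡ ((I ≡ᵇ p) ∧ ((q <ᵇ J) ∧ (J ≤ᵇ p)))
inRange-∧-≡ᵇ I J p q with I ≟ p
... | no I≢p rewrite ≡ᵇ-false I≢p | ≡ᵇ-false (≢-sym I≢p) = ∧-zeroʳ (inRange I J)
... | yes refl rewrite ≡ᵇ-refl I with q <ᵇ J in eq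
...   | false = ∧-zeroʳ (inRange I J)
...   | true rewrite <ᵇ-true {0} {J} (≤-<-trans z≤n (<ᵇ-true⁻¹ {q} {J} eq)) = ∧-identityʳ (J ≤ᵇ I)

ι-∧-false : ∀ b → ι (b ∧ false) ≡ 0
ι-∧-false b = cong ι (∧-zeroʳ b)

xexp-inversionMono : ∀ I J p q →
  ι (inRange I J ∧ ((q <ᵇ p) ∧ ((p ≡ᵇ I) ∧ (q <ᵇ J)))) ≡ xexp (inversionMono (p ∷ q ∷ [])) I J
xexp-inversionMono I J p q with q <ᵇ p in eq
... | false = ι-∧-false (inRange I J)
... | true = trans (cong ι (inRange-∧-≡ᵇ I J p q)) (sym (xexp-xRun I J p q (<⇒≤ (<ᵇ-true⁻¹ {q} {p} eq))))

yexp-occurrenceMono : ∀ I J p q r →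
  ι (inRange I J ∧ ((r <ᵇ p) ∧ ((p <ᵇ q) ∧ ((p ≡ᵇ I) ∧ (r <ᵇ J)))))
    ≡ yexp (occurrenceMono (p ∷ q ∷ r ∷ [])) I J
yexp-occurrenceMono I J p q r with r <ᵇ p in eq | p <ᵇ q
... | false | _ = ι-∧-false (inRange I J)
... | true | false = ι-∧-false (inRange I J)
... | true | true = trans (cong ι (inRange-∧-≡ᵇ I J p r)) (sym (yexp-yRun I J p r (<⇒≤ (<ᵇ-true⁻¹ {r} {p} eq))))

weight≈factorisedWeight : ∀ π → weight π ≈ factorisedWeight π
weight≈factorisedWeight π = t-part , x-part , y-part
  where
  X = prodList inversionMono (subs 2 π)
  Y = prodList occurrenceMono (subs 3 π)
  t-part : N2341 π ≡ N2341 π * 1 + (texp X + texp Y)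
  t-part rewrite *-identityʳ (N2341 π)
               | texp-Exponent.prodList-zero inversionMono (subs 2 π) (texp-Exponent.inversionMono-zero (λ _ _ → refl))
               | texp-Exponent.prodList-zero occurrenceMono (subs 3 π) (texp-Exponent.occurrenceMono-zero (λ _ _ → refl))
               = sym (+-identityʳ (N2341 π))
  x-part : ∀ I J → (if inRange I J then xCount π I J else 0) ≡ N2341 π * 0 + (xexp X I J + xexp Y I J)
  x-part I J rewrite *-zeroʳ (N2341 π)
                   | xexp-Exponent.prodList-zero I J occurrenceMono (subs 3 π)
                       (xexp-Exponent.occurrenceMono-zero I J (λ _ _ → refl))
                   | +-identityʳ (xexp X I J) =
    trans (if-then-countB-else-0 (inRange I J) _ (subs 2 π))
          (sym (xexp-Exponent.prodList-countB I J inversionMono _ (subs 2 π) λ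
            { [] → sym (ι-∧-false (inRange I J))
            ; (p ∷ []) → sym (ι-∧-false (inRange I J))
            ; (p ∷ q ∷ []) → sym (xexp-inversionMono I J p q)
            ; (p ∷ q ∷ r ∷ s) → sym (ι-∧-false (inRange I J)) }))
  y-part : ∀ I J → (if inRange I J then yCount π I J else 0) ≡ N2341 π * 0 + (yexp X I J + yexp Y I J)
  y-part I J rewrite *-zeroʳ (N2341 π)
                   | yexp-Exponent.prodList-zero I J inversionMono (subs 2 π)
                       (yexp-Exponent.inversionMono-zero I J (λ _ _ → refl)) =
    trans (if-then-countB-else-0 (inRange I J) _ (subs 3 π))
          (sym (yexp-Exponent.prodList-countB I J occurrenceMono _ (subs 3 π) λ
            { [] → sym (ι-∧-false (inRange I J))
            ; (p ∷ []) → sym (ι-∧-false (inRange I J))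
            ; (p ∷ q ∷ []) → sym (ι-∧-false (inRange I J))
            ; (p ∷ q ∷ r ∷ []) → sym (yexp-occurrenceMono I J p q r)
            ; (p ∷ q ∷ r ∷ s ∷ t) → sym (ι-∧-false (inRange I J)) }))

-- Occurrences of 2341 and lowering the entries above i

is2341 : List ℕ → Bool
is2341 s = listEqᵇ (red s) (2 ∷ 3 ∷ 4 ∷ 1 ∷ [])

extends2341 : ℕ → List ℕ → Bool
extends2341 i (p ∷ q ∷ r ∷ []) = ((r <ᵇ p) ∧ (p <ᵇ q)) ∧ ((r <ᵇ i) ∧ (i <ᵇ p))
extends2341 i _ = false

red-map : {P : ℕ → Set} (g : ℕ → ℕ) → (∀ {w v} → P w → P v → (g w <ᵇ g v) ≡ (w <ᵇ v)) →
  ∀ {s} → All P s → red (map g s) ≡ red s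
red-map {P} g g-<ᵇ {s} ps = trans (sym (map-∘ s)) (map-cong-local (Allₚ.map rank ps))
  where
  rank : ∀ {v} → P v → suc (countB (_<ᵇ g v) (map g s)) ≡ suc (countB (_<ᵇ v) s)
  rank {v} pv = cong suc (trans (countB-map (_<ᵇ g v) g s) (countB-cong (λ pw → g-<ᵇ pw pv) ps))

N2341-map : {P : ℕ → Set} (g : ℕ → ℕ) → (∀ {w v} → P w → P v → (g w <ᵇ g v) ≡ (w <ᵇ v)) →
  ∀ {s} → All P s → N2341 (map g s) ≡ N2341 s
N2341-map g g-<ᵇ {s} ps = begin
  countB is2341 (subs 4 (map g s))           ≡⟨ cong (countB is2341) (subs-map 4 g s) ⟩
  countB is2341 (map (map g) (subs 4 s))     ≡⟨ countB-map is2341 (map g) (subs 4 s) ⟩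
  countB (is2341 ∘ map g) (subs 4 s)
    ≡⟨ countB-cong (cong (λ r → listEqᵇ r _) ∘ red-map g g-<ᵇ) (subs-All 4 ps) ⟩
  countB is2341 (subs 4 s)                   ∎
  where open ≡-Reasoning

agreeEverywhere : ∀ n → (Vec Bool n → Bool) → (Vec Bool n → Bool) → Bool
agreeEverywhere zero f g = ⌊ f [] Bool.≟ g [] ⌋
agreeEverywhere (suc n) f g =
  agreeEverywhere n (f ∘ (true ∷_)) (g ∘ (true ∷_)) ∧ agreeEverywhere n (f ∘ (false ∷_)) (g ∘ (false ∷_))

agreeEverywhere-sound : ∀ n (f g : Vec Bool n → Bool) → T (agreeEverywhere n f g) → ∀ v → f v ≡ g v
agreeEverywhere-sound zero f g ok [] = toWitness ok
agreeEverywhere-sound (suc n) f g ok (true ∷ v) =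
  agreeEverywhere-sound n (f ∘ (true ∷_)) (g ∘ (true ∷_)) (proj₁ (Equivalence.to T-∧ ok)) v
agreeEverywhere-sound (suc n) f g ok (false ∷ v) =
  agreeEverywhere-sound n (f ∘ (false ∷_)) (g ∘ (false ∷_)) (proj₂ (Equivalence.to T-∧ ok)) v

-- is2341 (a ∷ b ∷ c ∷ d ∷ []) as a function of the comparisons a < b, a < c, a < d, b < c, b < d, c < d.
is2341-byComparisons : Vec Bool 6 → Bool
is2341-byComparisons (ab ∷ ac ∷ ad ∷ bc ∷ bd ∷ cd ∷ []) = listEqᵇ
  ( suc (ι (not ab) + (ι (not ac) + (ι (not ad) + 0)))
  ∷ suc (ι ab + (ι (not bc) + (ι (not bd) + 0)))
  ∷ suc (ι ac + (ι bc + (ι (not cd) + 0)))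
  ∷ suc (ι ad + (ι bd + (ι cd + 0))) ∷ [])
  (2 ∷ 3 ∷ 4 ∷ 1 ∷ [])

increasing-dabc : Vec Bool 6 → Bool
increasing-dabc (ab ∷ ac ∷ ad ∷ bc ∷ bd ∷ cd ∷ []) = ((not bd ∧ bc) ∧ (not ad ∧ ab)) ∧ (not cd ∧ ac)

∧-implied : ∀ b c → (T b → T c) → b ∧ c ≡ b
∧-implied false c _ = refl
∧-implied true c b⇒c = Equivalence.to T-≡ (b⇒c _)

is2341-distinct : ∀ {a b c d} → a ≢ b → a ≢ c → a ≢ d → b ≢ c → b ≢ d → c ≢ d →
  is2341 (a ∷ b ∷ c ∷ d ∷ [])
    ≡ (((d <ᵇ b) ∧ (b <ᵇ c)) ∧ ((d <ᵇ a) ∧ (a <ᵇ b))) ∧ ((d <ᵇ c) ∧ (a <ᵇ c))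
is2341-distinct {a} {b} {c} {d} a≢b a≢c a≢d b≢c b≢d c≢d
  rewrite <ᵇ-irrefl a | <ᵇ-irrefl b | <ᵇ-irrefl c | <ᵇ-irrefl d
        | <ᵇ-flip a≢b | <ᵇ-flip a≢c | <ᵇ-flip a≢d | <ᵇ-flip b≢c | <ᵇ-flip b≢d | <ᵇ-flip c≢d =
  agreeEverywhere-sound 6 is2341-byComparisons increasing-dabc _
    ((a <ᵇ b) ∷ (a <ᵇ c) ∷ (a <ᵇ d) ∷ (b <ᵇ c) ∷ (b <ᵇ d) ∷ (c <ᵇ d) ∷ [])

listEqᵇ-length≢ : ∀ (xs ys : List ℕ) → length xs ≢ length ys → listEqᵇ xs ys ≡ false
listEqᵇ-length≢ [] [] ≢ = contradiction refl ≢
listEqᵇ-length≢ [] (y ∷ ys) _ = refl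
listEqᵇ-length≢ (x ∷ xs) [] _ = refl
listEqᵇ-length≢ (x ∷ xs) (y ∷ ys) ≢ rewrite listEqᵇ-length≢ xs ys (≢ ∘ cong suc) = ∧-zeroʳ (x ≡ᵇ y)

is2341-head : ∀ i s → Unique (i ∷ s) → is2341 (i ∷ s) ≡ extends2341 i s
is2341-head i (p ∷ q ∷ r ∷ [])
             ((i≢p ∷ i≢q ∷ i≢r ∷ []) ∷ (p≢q ∷ p≢r ∷ []) ∷ (q≢r ∷ []) ∷ [] ∷ []) =
  trans (is2341-distinct i≢p i≢q i≢r p≢q p≢r q≢r) (∧-implied _ _ transitivity)
  where
  transitivity : T (extends2341 i (p ∷ q ∷ r ∷ [])) → T ((r <ᵇ q) ∧ (i <ᵇ q))
  transitivity h =
    let r<p∧p<q , r<i∧i<p = Equivalence.to T-∧ h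
        r<p , p<q = Equivalence.to T-∧ r<p∧p<q
        _ , i<p = Equivalence.to T-∧ r<i∧i<p
    in Equivalence.from T-∧ ( <⇒<ᵇ (<-trans (<ᵇ⇒< r p r<p) (<ᵇ⇒< p q p<q))
                            , <⇒<ᵇ (<-trans (<ᵇ⇒< i p i<p) (<ᵇ⇒< p q p<q)))
is2341-head i [] _ = listEqᵇ-length≢ (red (i ∷ [])) (2 ∷ 3 ∷ 4 ∷ 1 ∷ []) (λ ())
is2341-head i s@(_ ∷ []) _ = listEqᵇ-length≢ (red (i ∷ s)) (2 ∷ 3 ∷ 4 ∷ 1 ∷ []) (λ ())
is2341-head i s@(_ ∷ _ ∷ []) _ = listEqᵇ-length≢ (red (i ∷ s)) (2 ∷ 3 ∷ 4 ∷ 1 ∷ []) (λ ())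
is2341-head i s@(_ ∷ _ ∷ _ ∷ _ ∷ _) _ = listEqᵇ-length≢ (red (i ∷ s)) (2 ∷ 3 ∷ 4 ∷ 1 ∷ []) (λ ())

N2341-cons : ∀ i rest → Unique (i ∷ rest) → N2341 (i ∷ rest) ≡ countB (extends2341 i) (subs 3 rest) + N2341 rest
N2341-cons i rest (i∉rest ∷ u) = begin
  countB is2341 (map (i ∷_) (subs 3 rest) ++ subs 4 rest)
    ≡⟨ countB-++ is2341 (map (i ∷_) (subs 3 rest)) (subs 4 rest) ⟩
  countB is2341 (map (i ∷_) (subs 3 rest)) + N2341 rest
    ≡⟨ cong (_+ N2341 rest) (countB-map is2341 (i ∷_) (subs 3 rest)) ⟩
  countB (is2341 ∘ (i ∷_)) (subs 3 rest) + N2341 rest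
    ≡⟨ cong (_+ N2341 rest) (countB-cong (λ (i∉s , us) → is2341-head i _ (i∉s ∷ us))
                                         (Allₚ.zip (subs-All 3 i∉rest , subs-Unique 3 u))) ⟩
  countB (extends2341 i) (subs 3 rest) + N2341 rest ∎
  where open ≡-Reasoning

lower : ℕ → ℕ → ℕ
lower i v = if i <ᵇ v then v ∸ 1 else v

lower-> : ∀ {i v} → i < v → lower i v ≡ v ∸ 1
lower-> {i} {v} i<v rewrite <ᵇ-true i<v = refl

lower-< : ∀ {i v} → v < i → lower i v ≡ v
lower-< {i} {v} v<i rewrite <ᵇ-false {i} {v} (<⇒≤ v<i) = refl

pred-<ᵇ : ∀ {w v} → 0 < w → 0 < v → (w ∸ 1 <ᵇ v ∸ 1) ≡ (w <ᵇ v)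
pred-<ᵇ {suc w} {suc v} _ _ = refl

lower-<ᵇ : ∀ i {w v} → w ≢ i → v ≢ i → (lower i w <ᵇ lower i v) ≡ (w <ᵇ v)
lower-<ᵇ i {w} {v} w≢i v≢i with <-cmp i w | <-cmp i v
... | tri≈ _ i≡w _ | _ = contradiction (sym i≡w) w≢i
... | _ | tri≈ _ i≡v _ = contradiction (sym i≡v) v≢i
... | tri< i<w _ _ | tri< i<v _ _ rewrite lower-> i<w | lower-> i<v = pred-<ᵇ (≤-<-trans z≤n i<w) (≤-<-trans z≤n i<v)
... | tri< i<w _ _ | tri> _ _ v<i rewrite lower-> i<w | lower-< v<i
  | <ᵇ-false {w ∸ 1} {v} (≤-trans (<⇒≤ v<i) (<⇒≤pred i<w)) | <ᵇ-false {w} {v} (<⇒≤ (<-trans v<i i<w)) = refl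
... | tri> _ _ w<i | tri< i<v _ _ rewrite lower-< w<i | lower-> i<v
  | <ᵇ-true (<-≤-trans w<i (<⇒≤pred i<v)) | <ᵇ-true (<-trans w<i i<v) = refl
... | tri> _ _ w<i | tri> _ _ v<i rewrite lower-< w<i | lower-< v<i = refl

lower-≤ : ∀ {n i v} → i ≤ n → v ≤ n → v ≢ i → lower i v ≤ n ∸ 1
lower-≤ {n} {i} {v} i≤n v≤n v≢i with i <ᵇ v in eq
... | true = ∸-monoˡ-≤ 1 v≤n
... | false = <⇒≤pred (<-≤-trans (≤∧≢⇒< (<ᵇ-false⁻¹ {i} {v} eq) v≢i) i≤n)

red-tail : ∀ n i rest → IsPerm n (i ∷ rest) → red rest ≡ map (lower i) rest
red-tail n i rest p =
  map-cong-local (Allₚ.map rank (Allₚ.zip ( Allₚ.tail (IsPerm-bounded n p)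
                                          , Allₚ.map ≢-sym (AllPairs.head (IsPerm-Unique n p)))))
  where
  below : ∀ {v b} → v ≤ n → (i <ᵇ v) ≡ b → ι b + countB (_<ᵇ v) rest ≡ v ∸ 1
  below {v} v≤n refl = trans (countB-↭ (_<ᵇ v) p) (countB-<-oneTo n v v≤n)
  rank : ∀ {v} → (1 ≤ v × v ≤ n) × v ≢ i → suc (countB (_<ᵇ v) rest) ≡ lower i v
  rank {v} ((1≤v , v≤n) , v≢i) with <-cmp i v
  ... | tri≈ _ i≡v _ = contradiction (sym i≡v) v≢i
  ... | tri< i<v _ _ rewrite lower-> i<v = below v≤n (<ᵇ-true i<v)
  ... | tri> _ _ v<i rewrite lower-< v<i =
    trans (cong suc (below v≤n (<ᵇ-false {i} {v} (<⇒≤ v<i)))) (m+[n∸m]≡n 1≤v)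

-- The substitution on runs

substX-below : ∀ {i b} c → b < i → substX i b c ≡ xv b c
substX-below {i} {b} c b<i rewrite <ᵇ-true b<i = refl

substY-below : ∀ {i b} c → b < i → substY i b c ≡ yv b c
substY-below {i} {b} c b<i rewrite <ᵇ-true b<i = refl

substX-left : ∀ {i b c} → i ≤ b → c < i → substX i b c ≡ yv i c · xv (suc b) c
substX-left {i} {b} {c} i≤b c<i rewrite <ᵇ-false {b} {i} i≤b | <ᵇ-true c<i = refl

substY-left : ∀ {i b c} → i ≤ b → c < i → substY i b c ≡ yv (suc b) c
substY-left {i} {b} {c} i≤b c<i rewrite <ᵇ-false {b} {i} i≤b | <ᵇ-true c<i = refl

substX-right : ∀ {i b c} → i ≤ b → i < c → substX i b c ≡ xv (suc b) (suc c)
substX-right {i} {b} {c} i≤b i<c rewrite <ᵇ-false {b} {i} i≤b | <ᵇ-false {c} {i} (<⇒≤ i<c) | <ᵇ-true i<c = refl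

substY-right : ∀ {i b c} → i ≤ b → i < c → substY i b c ≡ yv (suc b) (suc c)
substY-right {i} {b} {c} i≤b i<c rewrite <ᵇ-false {b} {i} i≤b | <ᵇ-false {c} {i} (<⇒≤ i<c) | <ᵇ-true i<c = refl

substX-diag : ∀ {i b} → i ≤ b → substX i b i ≡ yv i i · (xv (suc b) i · xv (suc b) (suc i))
substX-diag {i} {b} i≤b rewrite <ᵇ-false {b} {i} i≤b | <ᵇ-irrefl i = refl

substY-diag : ∀ {i b} → i ≤ b → substY i b i ≡ tv · (yv (suc b) i · yv (suc b) (suc i))
substY-diag {i} {b} i≤b rewrite <ᵇ-false {b} {i} i≤b | <ᵇ-irrefl i = refl

m+n≡o⇒o∸m≡n : ∀ {o} m n → m + n ≡ o → o ∸ m ≡ n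
m+n≡o⇒o∸m≡n m n refl = m+n∸m≡n m n

straddle-length : ∀ q K r → (suc (q + K) + r) ∸ q ≡ K + suc r
straddle-length q K r = m+n≡o⇒o∸m≡n q (K + suc r) (trans (sym (+-assoc q K (suc r))) (+-suc (q + K) r))

straddle-length′ : ∀ q K r → suc (suc (q + K) + r) ∸ q ≡ K + suc (suc r)
straddle-length′ q K r = trans (cong (_∸ q) (sym (+-suc (suc (q + K)) r))) (straddle-length q K (suc r))

-- With i = q + K + 1 and p = i + r + 1, the range q < j ≤ p - 1 splits at j = i.
substX-straddle : ∀ q K r → let i = suc (q + K) in
  prodRange q ((i + r) ∸ q) (substX i (i + r)) ≈ (xRun (suc (i + r)) q · yRun i q)
substX-straddle q K r = begin
  prodRange q ((i + r) ∸ q) S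
    ≡⟨ cong (λ l → prodRange q l S) (straddle-length q K r) ⟩
  prodRange q (K + suc r) S
    ≈⟨ prodRange-+ q K (suc r) S ⟩
  prodRange q K S · (S i · prodRange i r S)
    ≈⟨ ·-cong (≈-trans (prodRange-cong q K (λ j _ j≤ → ≡⇒≈ (substX-left i≤b (s≤s j≤))))
                       (prodRange-distrib-· q K (yv i) (xv p)))
              (·-cong (≡⇒≈ (substX-diag i≤b))
                      (≈-trans (prodRange-cong i r (λ j i<j _ → ≡⇒≈ (substX-right i≤b i<j)))
                               (prodRange-shift i r (xv p)))) ⟩
  (Yl · Xl) · ((yv i i · (xv p i · xv p (suc i))) · Xr)
    ≈⟨ solve 6 (λ yl xl yii xpi xpi′ xr → (yl ⊕ xl) ⊕ ((yii ⊕ (xpi ⊕ xpi′)) ⊕ xr) ⊜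
                                             (xl ⊕ (xpi ⊕ (xpi′ ⊕ xr))) ⊕ (yl ⊕ yii))
               ≈-refl Yl Xl (yv i i) (xv p i) (xv p (suc i)) Xr ⟩
  (Xl · (xv p i · (xv p (suc i) · Xr))) · (Yl · yv i i)
    ≈⟨ ·-cong (≈-sym (prodRange-+ q K (suc (suc r)) (xv p))) (≈-sym (prodRange-suc q K (yv i))) ⟩
  prodRange q (K + suc (suc r)) (xv p) · prodRange q (suc K) (yv i)
    ≡⟨ cong₂ (λ l l′ → prodRange q l (xv p) · prodRange q l′ (yv i))
             (sym (straddle-length′ q K r)) (sym (m+n≡o⇒o∸m≡n q (suc K) (+-suc q K))) ⟩
  xRun p q · yRun i q ∎
  where
  open ≈-Reasoning
  i = suc (q + K)
  b = i + r
  p = suc b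
  S = substX i b
  i≤b = m≤m+n i r
  Yl = prodRange q K (yv i)
  Xl = prodRange q K (xv p)
  Xr = prodRange (suc i) r (xv p)

substY-straddle : ∀ r K s → let i = suc (r + K) in
  prodRange r ((i + s) ∸ r) (substY i (i + s)) ≈ (yRun (suc (i + s)) r · tv)
substY-straddle r K s = begin
  prodRange r ((i + s) ∸ r) S
    ≡⟨ cong (λ l → prodRange r l S) (straddle-length r K s) ⟩
  prodRange r (K + suc s) S
    ≈⟨ prodRange-+ r K (suc s) S ⟩
  prodRange r K S · (S i · prodRange i s S)
    ≈⟨ ·-cong (prodRange-cong r K (λ j _ j≤ → ≡⇒≈ (substY-left i≤b (s≤s j≤))))
              (·-cong (≡⇒≈ (substY-diag i≤b))
                      (≈-trans (prodRange-cong i s (λ j i<j _ → ≡⇒≈ (substY-right i≤b i<j)))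
                               (prodRange-shift i s (yv p)))) ⟩
  Yl · ((tv · (yv p i · yv p (suc i))) · Yr)
    ≈⟨ solve 5 (λ yl t ypi ypi′ yr → yl ⊕ ((t ⊕ (ypi ⊕ ypi′)) ⊕ yr) ⊜
                                      (yl ⊕ (ypi ⊕ (ypi′ ⊕ yr))) ⊕ t)
               ≈-refl Yl tv (yv p i) (yv p (suc i)) Yr ⟩
  (Yl · (yv p i · (yv p (suc i) · Yr))) · tv
    ≈⟨ ·-cong (≈-sym (prodRange-+ r K (suc (suc s)) (yv p))) (≈-refl {tv}) ⟩
  prodRange r (K + suc (suc s)) (yv p) · tv
    ≡⟨ cong (λ l → prodRange r l (yv p) · tv) (sym (straddle-length′ r K s)) ⟩
  yRun p r · tv ∎
  where
  open ≈-Reasoning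
  i = suc (r + K)
  b = i + s
  p = suc b
  S = substY i b
  i≤b = m≤m+n i s
  Yl = prodRange r K (yv p)
  Yr = prodRange (suc i) s (yv p)

substX-lowered-run : ∀ i {p q} → p ≢ i → q ≢ i → q < p →
  prodRange (lower i q) (lower i p ∸ lower i q) (substX i (lower i p)) ≈ (xRun p q · occurrenceMono (i ∷ p ∷ q ∷ []))
substX-lowered-run i {p} {q} p≢i q≢i q<p with <-cmp i p | <-cmp i q
... | tri≈ _ i≡p _ | _ = contradiction (sym i≡p) p≢i
... | _ | tri≈ _ i≡q _ = contradiction (sym i≡q) q≢i
... | tri> _ _ p<i | _
  rewrite lower-< p<i | lower-< (<-trans q<p p<i) | <ᵇ-false {i} {p} (<⇒≤ p<i) | ∧-zeroʳ (q <ᵇ i) =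
  ≈-trans (prodRange-cong q (p ∸ q) (λ j _ _ → ≡⇒≈ (substX-below j p<i))) (≈-sym (·-identityʳ (xRun p q)))
... | tri< i<p _ _ | tri< i<q _ _ rewrite lower-> i<p | lower-> i<q | <ᵇ-false {q} {i} (<⇒≤ i<q) = above i<p i<q
  where
  above : ∀ {p q} → i < p → i < q →
    prodRange (q ∸ 1) ((p ∸ 1) ∸ (q ∸ 1)) (substX i (p ∸ 1)) ≈ (xRun p q · one)
  above {suc p₀} {suc q₀} (s≤s i≤p₀) (s≤s i≤q₀) =
    ≈-trans (prodRange-cong q₀ (p₀ ∸ q₀) λ j q₀<j _ →
               ≡⇒≈ (substX-right i≤p₀ (≤-<-trans i≤q₀ q₀<j)))
     (≈-trans (prodRange-shift q₀ (p₀ ∸ q₀) (xv (suc p₀))) (≈-sym (·-identityʳ _)))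
... | tri< i<p _ _ | tri> _ _ q<i rewrite lower-> i<p | lower-< q<i | <ᵇ-true q<i | <ᵇ-true i<p
  with K , refl ← m≤n⇒∃[o]m+o≡n q<i | r , refl ← m≤n⇒∃[o]m+o≡n i<p = substX-straddle q K r

substY-lowered-run : ∀ i {p r} → p ≢ i → r ≢ i → r < p →
  prodRange (lower i r) (lower i p ∸ lower i r) (substY i (lower i p))
    ≈ (yRun p r · (tv ^^ ι ((r <ᵇ i) ∧ (i <ᵇ p))))
substY-lowered-run i {p} {r} p≢i r≢i r<p with <-cmp i p | <-cmp i r
... | tri≈ _ i≡p _ | _ = contradiction (sym i≡p) p≢i
... | _ | tri≈ _ i≡r _ = contradiction (sym i≡r) r≢i
... | tri> _ _ p<i | _
  rewrite lower-< p<i | lower-< (<-trans r<p p<i) | <ᵇ-false {i} {p} (<⇒≤ p<i) | ∧-zeroʳ (r <ᵇ i) =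
  ≈-trans (prodRange-cong r (p ∸ r) (λ j _ _ → ≡⇒≈ (substY-below j p<i))) (≈-sym (·-identityʳ (yRun p r)))
... | tri< i<p _ _ | tri< i<r _ _ rewrite lower-> i<p | lower-> i<r | <ᵇ-false {r} {i} (<⇒≤ i<r) = above i<p i<r
  where
  above : ∀ {p r} → i < p → i < r →
    prodRange (r ∸ 1) ((p ∸ 1) ∸ (r ∸ 1)) (substY i (p ∸ 1)) ≈ (yRun p r · one)
  above {suc p₀} {suc r₀} (s≤s i≤p₀) (s≤s i≤r₀) =
    ≈-trans (prodRange-cong r₀ (p₀ ∸ r₀) λ j r₀<j _ →
               ≡⇒≈ (substY-right i≤p₀ (≤-<-trans i≤r₀ r₀<j)))
     (≈-trans (prodRange-shift r₀ (p₀ ∸ r₀) (yv (suc p₀))) (≈-sym (·-identityʳ _)))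
... | tri< i<p _ _ | tri> _ _ r<i rewrite lower-> i<p | lower-< r<i | <ᵇ-true r<i | <ᵇ-true i<p
  with K , refl ← m≤n⇒∃[o]m+o≡n r<i | s , refl ← m≤n⇒∃[o]m+o≡n i<p =
  ≈-trans (substY-straddle r K s) (·-cong (≈-refl {yRun _ r}) (≈-sym (^^-identityʳ tv)))

-- The substitution as a homomorphism

module Substitution (i m : ℕ) where

  A′ : Mono → Mono
  A′ = applyA' i m

  A′-cong : ∀ {M N} → M ≈ N → A′ M ≈ A′ N
  A′-cong (t , x , y) = ·-cong (^^-congʳ tv t)
    (prodTo-cong m (λ b _ → prodTo-cong b (λ c _ →
      ·-cong (^^-congʳ (substX i b c) (x b c)) (^^-congʳ (substY i b c) (y b c)))))

  term : Mono → ℕ → ℕ → Mono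
  term M b c = (substX i b c ^^ xexp M b c) · (substY i b c ^^ yexp M b c)

  term-· : ∀ M N b c → term (M · N) b c ≈ (term M b c · term N b c)
  term-· M N b c =
    ≈-trans (·-cong (^^-distrib-+ (substX i b c) (xexp M b c) (xexp N b c))
                    (^^-distrib-+ (substY i b c) (yexp M b c) (yexp N b c)))
            (interchange (substX i b c ^^ xexp M b c) _ _ _)

  A′-· : ∀ M N → A′ (M · N) ≈ (A′ M · A′ N)
  A′-· M N =
    ≈-trans (·-cong (^^-distrib-+ tv (texp M) (texp N))
                    (≈-trans (prodTo-cong m (λ b _ → ≈-trans (prodTo-cong b (λ c _ → term-· M N b c))
                                                             (prodTo-distrib-· b (term M b) (term N b))))
                             (prodTo-distrib-· m _ _)))
            (interchange (tv ^^ texp M) _ _ _)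

  A′-one : A′ one ≈ one
  A′-one = prodTo-trivial m (λ b _ → prodTo-trivial b (λ c _ → ≈-refl))

  A′-tv^^ : ∀ k → A′ (tv ^^ k) ≈ (tv ^^ k)
  A′-tv^^ k = ≈-trans (·-cong (^^-congʳ tv (*-identityʳ k)) (prodTo-trivial m (λ b _ → prodTo-trivial b (λ c _ →
      ·-cong (^^-congʳ (substX i b c) (*-zeroʳ k)) (^^-congʳ (substY i b c) (*-zeroʳ k))))))
    (·-identityʳ (tv ^^ k))

  A′-xv : ∀ b c → 1 ≤ c → c ≤ b → b ≤ m → A′ (xv b c) ≈ substX i b c
  A′-xv b c 1≤c c≤b b≤m =
    ≈-trans (prodTo²-δ m b c (λ b′ c′ e → (substX i b′ c′ ^^ e) · (substY i b′ c′ ^^ 0))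
                       (λ _ _ → ≈-refl) 1≤c c≤b b≤m)
            (≈-trans (·-identityʳ _) (^^-identityʳ (substX i b c)))

  A′-yv : ∀ b c → 1 ≤ c → c ≤ b → b ≤ m → A′ (yv b c) ≈ substY i b c
  A′-yv b c 1≤c c≤b b≤m =
    ≈-trans (prodTo²-δ m b c (λ b′ c′ e → (substX i b′ c′ ^^ 0) · (substY i b′ c′ ^^ e))
                       (λ _ _ → ≈-refl) 1≤c c≤b b≤m)
            (^^-identityʳ (substY i b c))

  A′-prodRange : ∀ a k f → A′ (prodRange a k f) ≈ prodRange a k (A′ ∘ f)
  A′-prodRange a zero f = A′-one
  A′-prodRange a (suc k) f =
    ≈-trans (A′-· (f (suc a)) _) (·-cong (≈-refl {A′ (f (suc a))}) (A′-prodRange (suc a) k f))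

  A′-prodList : {A : Set} (F : A → Mono) (xs : List A) → A′ (prodList F xs) ≈ prodList (A′ ∘ F) xs
  A′-prodList F [] = A′-one
  A′-prodList F (x ∷ xs) = ≈-trans (A′-· (F x) _) (·-cong (≈-refl {A′ (F x)}) (A′-prodList F xs))

  A′-xRun : ∀ p q → q ≤ p → p ≤ m → A′ (xRun p q) ≈ prodRange q (p ∸ q) (substX i p)
  A′-xRun p q q≤p p≤m = ≈-trans (A′-prodRange q (p ∸ q) (xv p)) (prodRange-cong q (p ∸ q) λ j q<j j≤ →
    A′-xv p j (≤-trans (s≤s z≤n) q<j) (subst (j ≤_) (m+[n∸m]≡n q≤p) j≤) p≤m)

  A′-yRun : ∀ p r → r ≤ p → p ≤ m → A′ (yRun p r) ≈ prodRange r (p ∸ r) (substY i p)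
  A′-yRun p r r≤p p≤m = ≈-trans (A′-prodRange r (p ∸ r) (yv p)) (prodRange-cong r (p ∸ r) λ j r<j j≤ →
    A′-yv p j (≤-trans (s≤s z≤n) r<j) (subst (j ≤_) (m+[n∸m]≡n r≤p) j≤) p≤m)

  A′-inversionMono-lower : ∀ {s} → All (λ v → v ≢ i × lower i v ≤ m) s →
    A′ (inversionMono (map (lower i) s)) ≈ (inversionMono s · occurrenceMono (i ∷ s))
  A′-inversionMono-lower {p ∷ q ∷ []} ((p≢i , p′≤m) ∷ (q≢i , _) ∷ [])
    rewrite lower-<ᵇ i q≢i p≢i with q <ᵇ p in eq
  ... | true =
    ≈-trans (A′-xRun (lower i p) (lower i q) (<⇒≤ (<ᵇ-true⁻¹ (trans (lower-<ᵇ i q≢i p≢i) eq))) p′≤m)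
            (substX-lowered-run i p≢i q≢i (<ᵇ-true⁻¹ {q} {p} eq))
  ... | false with q <ᵇ i in q<ᵇi
  ...   | false = A′-one
  ...   | true rewrite <ᵇ-false {i} {p} (<⇒≤ (≤-<-trans (<ᵇ-false⁻¹ {q} eq) (<ᵇ-true⁻¹ {q} q<ᵇi))) = A′-one
  A′-inversionMono-lower {[]} _ = A′-one
  A′-inversionMono-lower {_ ∷ []} _ = A′-one
  A′-inversionMono-lower {_ ∷ _ ∷ _ ∷ _} _ = A′-one

  A′-occurrenceMono-lower : ∀ {s} → All (λ v → v ≢ i × lower i v ≤ m) s →
    A′ (occurrenceMono (map (lower i) s)) ≈ (occurrenceMono s · (tv ^^ ι (extends2341 i s)))
  A′-occurrenceMono-lower {p ∷ q ∷ r ∷ []} ((p≢i , p′≤m) ∷ (q≢i , _) ∷ (r≢i , _) ∷ [])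
    rewrite lower-<ᵇ i r≢i p≢i | lower-<ᵇ i p≢i q≢i with r <ᵇ p in eq | p <ᵇ q
  ... | false | _ = A′-one
  ... | true | false = A′-one
  ... | true | true =
    ≈-trans (A′-yRun (lower i p) (lower i r) (<⇒≤ (<ᵇ-true⁻¹ (trans (lower-<ᵇ i r≢i p≢i) eq))) p′≤m)
            (substY-lowered-run i p≢i r≢i (<ᵇ-true⁻¹ {r} {p} eq))
  A′-occurrenceMono-lower {[]} _ = A′-one
  A′-occurrenceMono-lower {_ ∷ []} _ = A′-one
  A′-occurrenceMono-lower {_ ∷ _ ∷ []} _ = A′-one
  A′-occurrenceMono-lower {_ ∷ _ ∷ _ ∷ _ ∷ _} _ = A′-one

-- Each factor f j with j ≤ k + 1 occurs once for every q < j.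
prodTo-triangle : ∀ k (f : ℕ → Mono) →
  prodTo k (λ q → prodRange q (suc k ∸ q) f) ≈ prodTo (suc k) (λ j → f j ^^ (j ∸ 1))
prodTo-triangle zero f = ≈-refl
prodTo-triangle (suc k) f = begin
  prodTo k (λ q → prodRange q (suc (suc k) ∸ q) f) · prodRange (suc k) (suc (suc k) ∸ suc k) f
    ≈⟨ ·-cong (≈-trans (prodTo-cong k extend) (prodTo-distrib-· k (λ q → prodRange q (suc k ∸ q) f) (λ _ → F)))
              (≡⇒≈ (cong (λ l → prodRange (suc k) l f) (m+n∸n≡m 1 k))) ⟩
  (prodTo k (λ q → prodRange q (suc k ∸ q) f) · prodTo k (λ _ → F)) · (F · one)
    ≈⟨ ·-cong (·-cong (prodTo-triangle k f) (prodTo-const k F)) (≈-refl {F · one}) ⟩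
  (P · (F ^^ k)) · (F · one)
    ≈⟨ solve 3 (λ p fk f → (p ⊕ fk) ⊕ (f ⊕ id) ⊜ p ⊕ (f ⊕ fk)) ≈-refl P (F ^^ k) F ⟩
  P · (F · (F ^^ k)) ∎
  where
  open ≈-Reasoning
  F = f (suc (suc k))
  P = prodTo (suc k) (λ j → f j ^^ (j ∸ 1))
  extend : ∀ q → q ≤ k → prodRange q (suc (suc k) ∸ q) f ≈ (prodRange q (suc k ∸ q) f · F)
  extend q q≤k = ≈-trans (≡⇒≈ (cong (λ l → prodRange q l f) (+-∸-assoc 1 (m≤n⇒m≤1+n q≤k))))
    (≈-trans (prodRange-suc q (suc k ∸ q) f)
             (≡⇒≈ (cong (λ z → prodRange q (suc k ∸ q) f · f (suc z)) (m+[n∸m]≡n (m≤n⇒m≤1+n q≤k)))))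

-- The entries q < i of π contribute the inversions (i, q); the others contribute nothing.
inversions-of-head : ∀ n i₀ rest → IsPerm n (suc i₀ ∷ rest) →
  prodList inversionMono (map (suc i₀ ∷_) (subs 1 rest)) ≈ prefactor (suc i₀)
inversions-of-head n i₀ rest p = begin
  prodList inversionMono (map (i ∷_) (subs 1 rest))
    ≡⟨ prodList-map inversionMono (i ∷_) (subs 1 rest) ⟩
  prodList (inversionMono ∘ (i ∷_)) (subs 1 rest)
    ≡⟨ trans (cong (prodList (inversionMono ∘ (i ∷_))) (subs-1 rest))
             (prodList-map (inversionMono ∘ (i ∷_)) (_∷ []) rest) ⟩
  prodList h rest
    ≈⟨ ≈-trans (·-cong (≡⇒≈ h-i≡one) (≈-refl {prodList h rest})) (prodList-↭ h p) ⟩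
  prodList h (oneTo n)
    ≈⟨ prodList-applyUpTo n 0 h (λ _ → refl) ⟩
  prodRange 0 n h
    ≡⟨ cong (λ l → prodRange 0 l h) (sym (m+[n∸m]≡n i₀≤n)) ⟩
  prodRange 0 (i₀ + (n ∸ i₀)) h
    ≈⟨ prodRange-+ 0 i₀ (n ∸ i₀) h ⟩
  prodRange 0 i₀ h · prodRange i₀ (n ∸ i₀) h
    ≈⟨ ·-cong (≈-sym (prodTo≈prodRange i₀ h))
              (prodRange-trivial i₀ (n ∸ i₀) (λ j i₀<j _ → ≡⇒≈ (h-above i₀<j))) ⟩
  prodTo i₀ h · one
    ≈⟨ ≈-trans (·-identityʳ (prodTo i₀ h)) (prodTo-cong i₀ (λ q q≤i₀ → ≡⇒≈ (h-below (s≤s q≤i₀)))) ⟩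
  prodTo i₀ (λ q → xRun i q)
    ≈⟨ prodTo-triangle i₀ (xv i) ⟩
  prefactor i ∎
  where
  open ≈-Reasoning
  i = suc i₀
  h : ℕ → Mono
  h q = inversionMono (i ∷ q ∷ [])
  i₀≤n : i₀ ≤ n
  i₀≤n = ≤-trans (n≤1+n i₀) (proj₂ (Allₚ.head (IsPerm-bounded n p)))
  h-i≡one : one ≡ h i
  h-i≡one rewrite <ᵇ-irrefl i = refl
  h-above : ∀ {q} → i₀ < q → h q ≡ one
  h-above {q} i≤q rewrite <ᵇ-false {q} {i} i≤q = refl
  h-below : ∀ {q} → q < i → h q ≡ xRun i q
  h-below {q} q<i rewrite <ᵇ-true q<i = refl

-- Deleting the first entry

module Deletion (n i₀ : ℕ) (rest : List ℕ) (π-perm : IsPerm n (suc i₀ ∷ rest)) where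

  i = suc i₀
  open Substitution i (n ∸ 1)

  unique : Unique (i ∷ rest)
  unique = IsPerm-Unique n π-perm

  entries : All (λ v → v ≢ i × lower i v ≤ n ∸ 1) rest
  entries = Allₚ.zipWith (λ (v≢i , (_ , v≤n)) → v≢i , lower-≤ i≤n v≤n v≢i)
              (Allₚ.map ≢-sym (AllPairs.head unique) , Allₚ.tail bounds)
    where
    bounds = IsPerm-bounded n π-perm
    i≤n = proj₂ (Allₚ.head bounds)

  tail2341s head2341s tailInversions tailOccurrences headOccurrences headFactor : Mono
  tail2341s = tv ^^ N2341 rest
  head2341s = tv ^^ countB (extends2341 i) (subs 3 rest)
  tailInversions = prodList inversionMono (subs 2 rest)
  tailOccurrences = prodList occurrenceMono (subs 3 rest)
  headOccurrences = prodList (λ s → occurrenceMono (i ∷ s)) (subs 2 rest)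
  headFactor = head2341s · headOccurrences

  factorisedWeight-head : factorisedWeight (i ∷ rest) ≈ (prefactor i · (factorisedWeight rest · headFactor))
  factorisedWeight-head = begin
    (tv ^^ N2341 (i ∷ rest)) · (prodList inversionMono (map (i ∷_) (subs 1 rest) ++ subs 2 rest)
                                · prodList occurrenceMono (map (i ∷_) (subs 2 rest) ++ subs 3 rest))
      ≈⟨ ·-cong (≈-trans (^^-congʳ tv (N2341-cons i rest unique))
                         (^^-distrib-+ tv (countB (extends2341 i) (subs 3 rest)) (N2341 rest)))
                (·-cong (≈-trans (prodList-++ inversionMono (map (i ∷_) (subs 1 rest)) (subs 2 rest))
                                 (·-cong (inversions-of-head n i₀ rest π-perm) (≈-refl {tailInversions})))
                        (≈-trans (prodList-++ occurrenceMono (map (i ∷_) (subs 2 rest)) (subs 3 rest))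
                                 (·-cong (≡⇒≈ (prodList-map occurrenceMono (i ∷_) (subs 2 rest)))
                                         (≈-refl {tailOccurrences})))) ⟩
    (head2341s · tail2341s) · ((prefactor i · tailInversions) · (headOccurrences · tailOccurrences))
      ≈⟨ solve 6 (λ h t pf x yh y → (h ⊕ t) ⊕ ((pf ⊕ x) ⊕ (yh ⊕ y)) ⊜
                                     pf ⊕ ((t ⊕ (x ⊕ y)) ⊕ (h ⊕ yh)))
                 ≈-refl head2341s tail2341s (prefactor i) tailInversions headOccurrences tailOccurrences ⟩
    prefactor i · (factorisedWeight rest · headFactor) ∎
    where open ≈-Reasoning

  A′-inversions-lower :
    A′ (prodList (inversionMono ∘ map (lower i)) (subs 2 rest)) ≈ (tailInversions · headOccurrences)
  A′-inversions-lower = begin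
    A′ (prodList (inversionMono ∘ map (lower i)) (subs 2 rest))
      ≈⟨ A′-prodList (inversionMono ∘ map (lower i)) (subs 2 rest) ⟩
    prodList (A′ ∘ inversionMono ∘ map (lower i)) (subs 2 rest)
      ≈⟨ prodList-cong A′-inversionMono-lower (subs-All 2 entries) ⟩
    prodList (λ s → inversionMono s · occurrenceMono (i ∷ s)) (subs 2 rest)
      ≈⟨ prodList-distrib-· inversionMono (λ s → occurrenceMono (i ∷ s)) (subs 2 rest) ⟩
    tailInversions · headOccurrences ∎
    where open ≈-Reasoning

  A′-occurrences-lower :
    A′ (prodList (occurrenceMono ∘ map (lower i)) (subs 3 rest)) ≈ (tailOccurrences · head2341s)
  A′-occurrences-lower = begin
    A′ (prodList (occurrenceMono ∘ map (lower i)) (subs 3 rest))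
      ≈⟨ A′-prodList (occurrenceMono ∘ map (lower i)) (subs 3 rest) ⟩
    prodList (A′ ∘ occurrenceMono ∘ map (lower i)) (subs 3 rest)
      ≈⟨ prodList-cong A′-occurrenceMono-lower (subs-All 3 entries) ⟩
    prodList (λ s → occurrenceMono s · (tv ^^ ι (extends2341 i s))) (subs 3 rest)
      ≈⟨ prodList-distrib-· occurrenceMono (λ s → tv ^^ ι (extends2341 i s)) (subs 3 rest) ⟩
    tailOccurrences · prodList (λ s → tv ^^ ι (extends2341 i s)) (subs 3 rest)
      ≈⟨ ·-cong (≈-refl {tailOccurrences}) (prodList-^^-ι tv (extends2341 i) (subs 3 rest)) ⟩
    tailOccurrences · head2341s ∎
    where open ≈-Reasoning

  factorisedWeight-lower : factorisedWeight (map (lower i) rest)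
    ≡ tail2341s · (prodList (inversionMono ∘ map (lower i)) (subs 2 rest)
                   · prodList (occurrenceMono ∘ map (lower i)) (subs 3 rest))
  factorisedWeight-lower
    rewrite N2341-map (lower i) (lower-<ᵇ i) (Allₚ.map proj₁ entries)
          | subs-map 2 (lower i) rest | subs-map 3 (lower i) rest
          | prodList-map inversionMono (map (lower i)) (subs 2 rest)
          | prodList-map occurrenceMono (map (lower i)) (subs 3 rest) = refl

  A′-factorisedWeight-lower : A′ (factorisedWeight (map (lower i) rest)) ≈ (factorisedWeight rest · headFactor)
  A′-factorisedWeight-lower = begin
    A′ (factorisedWeight (map (lower i) rest))
      ≡⟨ cong A′ factorisedWeight-lower ⟩
    A′ (tail2341s · (Xl · Yl))
      ≈⟨ ≈-trans (A′-· tail2341s (Xl · Yl)) (·-cong (A′-tv^^ (N2341 rest)) (A′-· Xl Yl)) ⟩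
    tail2341s · (A′ Xl · A′ Yl)
      ≈⟨ ·-cong (≈-refl {tail2341s}) (·-cong A′-inversions-lower A′-occurrences-lower) ⟩
    tail2341s · ((tailInversions · headOccurrences) · (tailOccurrences · head2341s))
      ≈⟨ solve 5 (λ t x yh y h → t ⊕ ((x ⊕ yh) ⊕ (y ⊕ h)) ⊜ (t ⊕ (x ⊕ y)) ⊕ (h ⊕ yh))
                 ≈-refl tail2341s tailInversions headOccurrences tailOccurrences head2341s ⟩
    factorisedWeight rest · headFactor ∎
    where
    open ≈-Reasoning
    Xl = prodList (inversionMono ∘ map (lower i)) (subs 2 rest)
    Yl = prodList (occurrenceMono ∘ map (lower i)) (subs 3 rest)

mainTheorem8 : (n : ℕ) → 1 ≤ n → (i : ℕ) → (rest : List ℕ) →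
    IsPerm n (i ∷ rest) →
    weight (i ∷ rest) ≈ (prefactor i · applyA' i (n ∸ 1) (weight (red rest)))
mainTheorem8 n _ zero rest π-perm = contradiction (proj₁ (Allₚ.head (IsPerm-bounded n π-perm))) λ ()
mainTheorem8 n _ i@(suc i₀) rest π-perm = begin
  weight (i ∷ rest)
    ≈⟨ weight≈factorisedWeight (i ∷ rest) ⟩
  factorisedWeight (i ∷ rest)
    ≈⟨ factorisedWeight-head ⟩
  prefactor i · (factorisedWeight rest · headFactor)
    ≈⟨ ·-cong (≈-refl {prefactor i}) A′-factorisedWeight-lower ⟨
  prefactor i · A′ (factorisedWeight (map (lower i) rest))
    ≈⟨ ·-cong (≈-refl {prefactor i}) (A′-cong (weight≈factorisedWeight (map (lower i) rest))) ⟨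
  prefactor i · A′ (weight (map (lower i) rest))
    ≡⟨ cong (λ σ → prefactor i · A′ (weight σ)) (red-tail n i rest π-perm) ⟨
  prefactor i · A′ (weight (red rest)) ∎
  where
  open ≈-Reasoning
  open Substitution i (n ∸ 1) using (A′; A′-cong)
  open Deletion n i₀ rest π-perm using (factorisedWeight-head; headFactor; A′-factorisedWeight-lower)
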